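{- Let $S\in\{0,1\}^n$ and define $\delta(0)=\texttt{)}$ and $\delta(1)=\texttt{())}$, and $\Delta(S)=\texttt{(}^n\cdot\delta(S[1])\cdots\delta(S[n])$ (a balanced parentheses sequence). Then for every $i\in\{1,\dots,n\}$, $S.rank_1(i)=\big(\Delta(S).findclose(n-i+1)-n-i\big)/2$.
   Context: $S.rank_1(i)$ is the number of 1s in $S[1..i]$. For a balanced parentheses string $B$ and a position $p$ holding an open parenthesis, $B.findclose(p)$ is the position of the closed parenthesis matching it. -}

module Defs where

open import Data.Bool using (Bool; true; false)
open import Data.Nat using (ℕ; zero; suc; _+_; _∸_)
open import Data.List using (List; []; _∷_; _++_; replicate; concatMap; take; drop; length)

-- Bit sequences S ∈ {0,1}^n are lists of Bool (true = 1), positions 1-indexed.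

count₁ : List Bool → ℕ
count₁ [] = 0
count₁ (true ∷ s) = suc (count₁ s)
count₁ (false ∷ s) = count₁ s

rank₁ : List Bool → ℕ → ℕ
rank₁ S i = count₁ (take i S)

Paren : Set
Paren = Bool

open′ close′ : Paren
open′ = true
close′ = false

δ : Bool → List Paren
δ false = close′ ∷ []
δ true  = open′ ∷ close′ ∷ close′ ∷ []

Δ : List Bool → List Paren
Δ S = replicate (length S) open′ ++ concatMap δ S

-- scan w d k : w is the remaining string starting at (1-indexed) position k,
-- d ≥ 1 is the current depth of unclosed parentheses opened at/after the
-- starting position. Returns the position where the depth returns to 0
-- (0 if it never does, which does not happen for balanced input).
scan : List Paren → ℕ → ℕ → ℕ
scan [] d k = 0
scan (true ∷ w) d k = scan w (suc d) (suc k)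
scan (false ∷ w) zero k = 0
scan (false ∷ w) (suc zero) k = k
scan (false ∷ w) (suc (suc d)) k = scan w (suc d) (suc k)

-- findclose B p : position (1-indexed) of the ')' matching the '(' at position p
-- (meaningful when B[p] = '('; returns 0 otherwise).
findclose : List Paren → ℕ → ℕ
findclose B p with drop (p ∸ 1) B
... | true ∷ w = scan w 1 (suc p)
... | _ = 0

-- Δ(S) opens with n parentheses, so the '(' at position n − i + 1 is followed by i − 1
-- further '(' and the matching ')' is the one that brings the depth i back to 0. Each
-- block δ(b) contributes exactly one net ')' and has length 1 + 2b, so the match lies in
-- the i-th block, at position n + (i + 2·rank₁(S, i)).
module Submission where

open import Defs
open import Data.Bool using (Bool; true; false)
open import Data.Nat using (ℕ; zero; suc; _+_; _∸_; _≤_; _/_; _*_; s≤s)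
open import Data.Nat.Properties using (+-comm; +-suc; *-comm; m∸n+n≡m; m+n∸n≡m; m+n∸m≡n)
open import Data.Nat.DivMod using (m*n/n≡m)
open import Data.Nat.Tactic.RingSolver using (solve-∀)
open import Data.List using (List; []; _∷_; _++_; replicate; concatMap; drop; length)
open import Relation.Binary.PropositionalEquality using (_≡_; refl; sym; trans; cong; cong₂; module ≡-Reasoning)

scan-replicate-open : ∀ j w d k → scan (replicate j open′ ++ w) d k ≡ scan w (j + d) (j + k)
scan-replicate-open zero    w d k = refl
scan-replicate-open (suc j) w d k =
  trans (scan-replicate-open j w (suc d) (suc k)) (cong₂ (scan w) (+-suc j d) (+-suc j k))

scan-concatMap-δ : ∀ S m k → suc m ≤ length S →
  scan (concatMap δ S) (suc m) k ≡ k + m + 2 * rank₁ S (suc m)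
scan-concatMap-δ (false ∷ S) zero    k _       = closes k
  where
  closes : ∀ k → k ≡ k + 0 + 2 * 0
  closes = solve-∀
scan-concatMap-δ (true  ∷ S) zero    k _       = closes k
  where
  closes : ∀ k → 2 + k ≡ k + 0 + 2 * 1
  closes = solve-∀
scan-concatMap-δ (false ∷ S) (suc m) k (s≤s h) =
  trans (scan-concatMap-δ S m (suc k) h) (shift k m (rank₁ S (suc m)))
  where
  shift : ∀ k m r → suc k + m + 2 * r ≡ k + suc m + 2 * r
  shift = solve-∀
scan-concatMap-δ (true  ∷ S) (suc m) k (s≤s h) =
  trans (scan-concatMap-δ S m (3 + k) h) (shift k m (rank₁ S (suc m)))
  where
  shift : ∀ k m r → 3 + k + m + 2 * r ≡ k + suc m + 2 * suc r
  shift = solve-∀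

drop-replicate-++ : ∀ {A : Set} a b (x : A) w → drop a (replicate (a + b) x ++ w) ≡ replicate b x ++ w
drop-replicate-++ zero    b x w = refl
drop-replicate-++ (suc a) b x w = drop-replicate-++ a b x w

findclose-open : ∀ B p w → drop (p ∸ 1) B ≡ open′ ∷ w → findclose B p ≡ scan w 1 (suc p)
findclose-open B p w eq rewrite eq = refl

findclose-Δ : ∀ S i → 1 ≤ i → i ≤ length S →
  findclose (Δ S) (length S ∸ i + 1) ≡ length S + (i + 2 * rank₁ S i)
findclose-Δ S (suc j) _ i≤n = begin
  findclose (Δ S) (a + 1)        ≡⟨ findclose-open (Δ S) (a + 1) _ prefix ⟩
  scan (replicate j open′ ++ C) 1 (suc (a + 1))
                                 ≡⟨ scan-replicate-open j C 1 (suc (a + 1)) ⟩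
  scan C (j + 1) (j + suc (a + 1))
                                 ≡⟨ cong (λ d → scan C d (j + suc (a + 1))) (+-comm j 1) ⟩
  scan C (suc j) (j + suc (a + 1))
                                 ≡⟨ scan-concatMap-δ S j (j + suc (a + 1)) i≤n ⟩
  j + suc (a + 1) + j + 2 * r    ≡⟨ regroup j a r ⟩
  (a + suc j) + (suc j + 2 * r)  ≡⟨ cong (_+ (suc j + 2 * r)) n≡a+i ⟨
  n + (suc j + 2 * r)            ∎
  where
  open ≡-Reasoning
  n = length S
  a = n ∸ suc j
  r = rank₁ S (suc j)
  C = concatMap δ S
  n≡a+i : n ≡ a + suc j
  n≡a+i = sym (m∸n+n≡m i≤n)
  prefix : drop (a + 1 ∸ 1) (Δ S) ≡ open′ ∷ (replicate j open′ ++ C)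
  prefix = trans (cong (λ x → drop x (Δ S)) (m+n∸n≡m a 1))
             (trans (cong (λ x → drop a (replicate x open′ ++ C)) n≡a+i)
                    (drop-replicate-++ a (suc j) open′ C))
  regroup : ∀ j a r → j + suc (a + 1) + j + 2 * r ≡ (a + suc j) + (suc j + 2 * r)
  regroup = solve-∀

lemma16 : (S : List Bool) → (i : ℕ) → 1 ≤ i → i ≤ length S →
    rank₁ S i ≡ (findclose (Δ S) (length S ∸ i + 1) ∸ length S ∸ i) / 2
lemma16 S i 1≤i i≤n = sym (begin
  (findclose (Δ S) (n ∸ i + 1) ∸ n ∸ i) / 2
    ≡⟨ cong (λ x → (x ∸ n ∸ i) / 2) (findclose-Δ S i 1≤i i≤n) ⟩
  (n + (i + 2 * r) ∸ n ∸ i) / 2  ≡⟨ cong (λ x → (x ∸ i) / 2) (m+n∸m≡n n (i + 2 * r)) ⟩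
  (i + 2 * r ∸ i) / 2            ≡⟨ cong (_/ 2) (m+n∸m≡n i (2 * r)) ⟩
  2 * r / 2                      ≡⟨ cong (_/ 2) (*-comm 2 r) ⟩
  r * 2 / 2                      ≡⟨ m*n/n≡m r 2 ⟩
  r                              ∎)
  where
  open ≡-Reasoning
  n = length S
  r = rank₁ S i
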